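{- Let $v>k>i\ge 0$ be integers with $v\ge 2k$ and $(v,k,i)\neq(2k,k,0)$, let $X=J(v,k,i)$ and $\Delta=v-2k+2i$. Let $A,B$ be vertices of $X$ and $x=|A\cap B|$. Then $$\mathrm{dist}(A,B)= \begin{cases} 3 & \text{if } x<\min\{i,k-\Delta\}; \\ \lceil\frac{k-x}{k-i}\rceil & \text{if } k-\Delta\leq x< i; \\ \min\{2\lceil \frac{k-x}{\Delta} \rceil,2\lceil \frac{x-i}{\Delta} \rceil +1\} & \text{if } x \geq i. \end{cases}$$
   Context: For integers $v>k>i\ge 0$, the generalized Johnson graph $J(v,k,i)$ is the simple undirected graph whose vertices are the $k$-element subsets of a fixed $v$-element set, two vertices $A,B$ being adjacent iff $|A\cap B|=i$. $\mathrm{dist}$ denotes the graph distance. -}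

module Defs where

open import Data.Nat using (ℕ; zero; suc; _+_; _*_; _∸_; _≤_; _/_)
open import Data.Fin.Subset using (Subset; _∩_; ∣_∣)
open import Data.Product using (_×_)
open import Relation.Binary.PropositionalEquality using (_≡_)

-- Adjacency in the generalized Johnson graph J(v,k,i):
-- B is a k-subset and |A ∩ B| = i.  (Vertices = k-subsets of Fin v.)
-- Walk v k i A C n : a walk of length n from A to C in J(v,k,i) whose
-- every vertex after A is a k-subset (A itself is assumed a k-subset).
data Walk (v k i : ℕ) : Subset v → Subset v → ℕ → Set where
  here : ∀ {A} → Walk v k i A A 0
  step : ∀ {A B C n} → ∣ B ∣ ≡ k → ∣ A ∩ B ∣ ≡ i →
         Walk v k i B C n → Walk v k i A C (suc n)

IsDist : (v k i : ℕ) → Subset v → Subset v → ℕ → Set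
IsDist v k i A C d = Walk v k i A C d × (∀ m → Walk v k i A C m → d ≤ m)

-- ceiling of a / b for b > 0 (value for b = 0 is irrelevant, set to 0)
ceilDiv : ℕ → ℕ → ℕ
ceilDiv a zero = 0
ceilDiv a (suc b) = (a + b) / suc b

-- Δ = v - 2k + 2i (natural subtraction is exact since v ≥ 2k)
Δ : ℕ → ℕ → ℕ → ℕ
Δ v k i = (v ∸ 2 * k) + 2 * i

-- Write f(x) for the right-hand side of the formula as a function of x = |A ∩ B|.
-- Two facts about f give dist(A, B) = f(|A ∩ B|).  First, f drops by at most one
-- along an edge: if |A ∩ A'| = i then f(|A ∩ C|) ≤ 1 + f(|A' ∩ C|) for every
-- k-set C, because inclusion–exclusion for A, A', C confines the pair
-- (|A ∩ C|, |A' ∩ C|) to a region on which this is elementary arithmetic; together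
-- with f(k) = 0 this bounds every walk from below.  Second, f can always drop by one:
-- unless A = B there is a neighbour A' of A with f(|A' ∩ B|) = f(|A ∩ B|) - 1, built
-- by prescribing how many elements A' takes from A ∩ B, A ∖ B, B ∖ A and the
-- complement of A ∪ B, with a choice adapted to the case of the formula x falls in.

module Submission where

open import Algebra.Properties.CommutativeSemigroup using (xy∙z≈xz∙y)
open import Data.Bool.Base using (true; false)
open import Data.Empty using (⊥-elim)
open import Data.Fin.Subset using (Subset; _∩_; _∪_; _─_; ∁; ∣_∣)
open import Data.Fin.Subset.Properties
  using (∣p∣≤n; ∣p∩q∣≤∣p∣; ∣p∩q∣≤∣q∣; ∣∁p∣≡n∸∣p∣; p⊆q⇒∣p∣≤∣q∣; x∈p∩q⁺; x∈p∩q⁻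
        ; ∩-comm; ∩-idem; ∩-distribʳ-∪)
open import Data.List.Base using (_∷_; [])
open import Data.Nat.Base
open import Data.Nat.DivMod using (/-monoˡ-≤; m<n⇒m/n≡0; m≥n⇒m/n>0; m/n≡1+[m∸n]/n)
open import Data.Nat.Properties
open import Data.Nat.Tactic.RingSolver using (solve; solve-∀)
open import Data.Product.Base using (∃; _×_; _,_; proj₁; map₂)
open import Data.Sum.Base using (inj₁; inj₂)
open import Relation.Binary.PropositionalEquality
open import Relation.Nullary using (¬_; yes; no; contradiction)

open import Defs

-- l ≤ r follows from a sum p ≤ q of hypotheses whenever l + q = r + p, an identity
-- the ring solver checks.
linear : ∀ {l r p q} → p ≤ q → l + q ≡ r + p → l ≤ r
linear {l} {r} {p} {q} p≤q eq = +-cancelʳ-≤ q l r (subst (_≤ r + q) (sym eq) (+-monoʳ-≤ r p≤q))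

linear-≡ : ∀ {l r p q} → p ≡ q → l + q ≡ r + p → l ≡ r
linear-≡ {l} {r} refl eq = +-cancelʳ-≡ _ l r eq

infixr 5 _⊕_
_⊕_ : ∀ {a b c d} → a ≤ b → c ≤ d → a + c ≤ b + d
_⊕_ = +-mono-≤

≡⇒≥ : ∀ {m n} → m ≡ n → n ≤ m
≡⇒≥ eq = ≤-reflexive (sym eq)

m≡n+o⇒m∸n≡o : ∀ {m} n {o} → m ≡ n + o → m ∸ n ≡ o
m≡n+o⇒m∸n≡o n {o} refl = m+n∸m≡n n o

m+n≤o+p⇒m∸o≤p∸n : ∀ {m n o p} → m + n ≤ o + p → m ∸ o ≤ p ∸ n
m+n≤o+p⇒m∸o≤p∸n {m} {n} {o} {p} le = begin
  m ∸ o             ≤⟨ ∸-monoˡ-≤ o (m+n≤o⇒m≤o∸n m le) ⟩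
  (o + p) ∸ n ∸ o   ≡⟨ ∸-+-assoc (o + p) n o ⟩
  (o + p) ∸ (n + o) ≡⟨ cong ((o + p) ∸_) (+-comm n o) ⟩
  (o + p) ∸ (o + n) ≡⟨ [m+n]∸[m+o]≡n∸o o p n ⟩
  p ∸ n             ∎
  where open ≤-Reasoning

2*[1+n]≡1+[2*n+1] : ∀ n → 2 * suc n ≡ suc (2 * n + 1)
2*[1+n]≡1+[2*n+1] = solve-∀

ceilDiv-monoˡ-≤ : ∀ {a b} d → a ≤ b → ceilDiv a (suc d) ≤ ceilDiv b (suc d)
ceilDiv-monoˡ-≤ d a≤b = /-monoˡ-≤ (suc d) (+-monoˡ-≤ d a≤b)

ceilDiv-+-suc : ∀ a d → ceilDiv (a + suc d) (suc d) ≡ suc (ceilDiv a (suc d))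
ceilDiv-+-suc a d = begin
  (a + suc d + d) / suc d                ≡⟨ m/n≡1+[m∸n]/n d+1≤ ⟩
  suc ((a + suc d + d ∸ suc d) / suc d)  ≡⟨ cong (λ n → suc ((n ∸ suc d) / suc d)) (sym (shuffle a d)) ⟩
  suc ((a + d + suc d ∸ suc d) / suc d)  ≡⟨ cong (λ n → suc (n / suc d)) (m+n∸n≡m (a + d) (suc d)) ⟩
  suc ((a + d) / suc d)                  ∎
  where
  open ≡-Reasoning
  shuffle : ∀ a d → a + d + suc d ≡ a + suc d + d
  shuffle = solve-∀
  d+1≤ : suc d ≤ a + suc d + d
  d+1≤ = ≤-trans (m≤n+m (suc d) (a + d)) (≤-reflexive (shuffle a d))

ceilDiv-zero : ∀ d → ceilDiv 0 (suc d) ≡ 0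
ceilDiv-zero d = m<n⇒m/n≡0 (n<1+n d)

ceilDiv-pos : ∀ {a} d → 1 ≤ a → 1 ≤ ceilDiv a (suc d)
ceilDiv-pos {suc a} d _ = m≥n⇒m/n>0 (s≤s (m≤n+m d a))

ceilDiv-self : ∀ d → ceilDiv (suc d) (suc d) ≡ 1
ceilDiv-self d = trans (ceilDiv-+-suc 0 d) (cong suc (ceilDiv-zero d))

ceilDiv≤1 : ∀ {a} d → a ≤ suc d → ceilDiv a (suc d) ≤ 1
ceilDiv≤1 d a≤ = ≤-trans (ceilDiv-monoˡ-≤ d a≤) (≤-reflexive (ceilDiv-self d))

ceilDiv≤2 : ∀ {a} d → a ≤ suc d + suc d → ceilDiv a (suc d) ≤ 2
ceilDiv≤2 d a≤ = ≤-trans (ceilDiv-monoˡ-≤ d a≤)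
  (≤-reflexive (trans (ceilDiv-+-suc (suc d) d) (cong suc (ceilDiv-self d))))

ceilDiv≥2 : ∀ {a} d → suc d < a → 2 ≤ ceilDiv a (suc d)
ceilDiv≥2 d d<a =
  ≤-trans (≡⇒≥ (trans (ceilDiv-+-suc 1 d) (cong suc (ceilDiv-one d)))) (ceilDiv-monoˡ-≤ d d<a)
  where
  ceilDiv-one : ∀ d → ceilDiv 1 (suc d) ≡ 1
  ceilDiv-one d = ≤-antisym (ceilDiv≤1 d (s≤s z≤n)) (ceilDiv-pos d (s≤s z≤n))

-- Sizes of subsets

-- Vec's constructors are opened only here: next to List's they make the variable
-- lists passed to the ring solver ambiguous.
module _ where
  open import Data.Vec.Base using ([]; _∷_)

  ∣p∪q∣+∣p∩q∣≡∣p∣+∣q∣ : ∀ {n} (p q : Subset n) → ∣ p ∪ q ∣ + ∣ p ∩ q ∣ ≡ ∣ p ∣ + ∣ q ∣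
  ∣p∪q∣+∣p∩q∣≡∣p∣+∣q∣ [] [] = refl
  ∣p∪q∣+∣p∩q∣≡∣p∣+∣q∣ (true ∷ p) (true ∷ q) =
    cong suc (trans (+-suc ∣ p ∪ q ∣ ∣ p ∩ q ∣)
                    (trans (cong suc (∣p∪q∣+∣p∩q∣≡∣p∣+∣q∣ p q)) (sym (+-suc ∣ p ∣ ∣ q ∣))))
  ∣p∪q∣+∣p∩q∣≡∣p∣+∣q∣ (true ∷ p) (false ∷ q) = cong suc (∣p∪q∣+∣p∩q∣≡∣p∣+∣q∣ p q)
  ∣p∪q∣+∣p∩q∣≡∣p∣+∣q∣ (false ∷ p) (true ∷ q) =
    trans (cong suc (∣p∪q∣+∣p∩q∣≡∣p∣+∣q∣ p q)) (sym (+-suc ∣ p ∣ ∣ q ∣))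
  ∣p∪q∣+∣p∩q∣≡∣p∣+∣q∣ (false ∷ p) (false ∷ q) = ∣p∪q∣+∣p∩q∣≡∣p∣+∣q∣ p q

  ∣p∪q∣≤∣p∣+∣q∣ : ∀ {n} (p q : Subset n) → ∣ p ∪ q ∣ ≤ ∣ p ∣ + ∣ q ∣
  ∣p∪q∣≤∣p∣+∣q∣ p q = ≤-trans (m≤m+n ∣ p ∪ q ∣ ∣ p ∩ q ∣) (≤-reflexive (∣p∪q∣+∣p∩q∣≡∣p∣+∣q∣ p q))

  ∣p∣+∣q∣≤∣p∩q∣+n : ∀ {n} (p q : Subset n) → ∣ p ∣ + ∣ q ∣ ≤ ∣ p ∩ q ∣ + n
  ∣p∣+∣q∣≤∣p∩q∣+n {n} p q = begin
    ∣ p ∣ + ∣ q ∣          ≡⟨ ∣p∪q∣+∣p∩q∣≡∣p∣+∣q∣ p q ⟨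
    ∣ p ∪ q ∣ + ∣ p ∩ q ∣  ≤⟨ +-monoˡ-≤ ∣ p ∩ q ∣ (∣p∣≤n (p ∪ q)) ⟩
    n + ∣ p ∩ q ∣          ≡⟨ +-comm n ∣ p ∩ q ∣ ⟩
    ∣ p ∩ q ∣ + n          ∎
    where open ≤-Reasoning

  ∣p∩r∣+∣q∩r∣≤∣p∩q∣+∣r∣ : ∀ {n} (p q r : Subset n) → ∣ p ∩ r ∣ + ∣ q ∩ r ∣ ≤ ∣ p ∩ q ∣ + ∣ r ∣
  ∣p∩r∣+∣q∩r∣≤∣p∩q∣+∣r∣ p q r = begin
    ∣ p ∩ r ∣ + ∣ q ∩ r ∣                            ≡⟨ ∣p∪q∣+∣p∩q∣≡∣p∣+∣q∣ (p ∩ r) (q ∩ r) ⟨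
    ∣ (p ∩ r) ∪ (q ∩ r) ∣ + ∣ (p ∩ r) ∩ (q ∩ r) ∣    ≤⟨ +-mono-≤ union≤ intersection≤ ⟩
    ∣ r ∣ + ∣ p ∩ q ∣                                ≡⟨ +-comm ∣ r ∣ ∣ p ∩ q ∣ ⟩
    ∣ p ∩ q ∣ + ∣ r ∣                                ∎
    where
    open ≤-Reasoning
    union≤ : ∣ (p ∩ r) ∪ (q ∩ r) ∣ ≤ ∣ r ∣
    union≤ = subst (λ s → ∣ s ∣ ≤ ∣ r ∣) (∩-distribʳ-∪ r p q) (∣p∩q∣≤∣q∣ (p ∪ q) r)
    intersection≤ : ∣ (p ∩ r) ∩ (q ∩ r) ∣ ≤ ∣ p ∩ q ∣
    intersection≤ = p⊆q⇒∣p∣≤∣q∣ λ x∈ →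
      let x∈p∩r , x∈q∩r = x∈p∩q⁻ (p ∩ r) (q ∩ r) x∈
      in x∈p∩q⁺ (proj₁ (x∈p∩q⁻ p r x∈p∩r) , proj₁ (x∈p∩q⁻ q r x∈q∩r))

  ∣p∣+∣q∣+∣r∣≤∣p∩q∣+∣p∩r∣+∣q∩r∣+n : ∀ {n} (p q r : Subset n) →
    ∣ p ∣ + ∣ q ∣ + ∣ r ∣ ≤ ∣ p ∩ q ∣ + (∣ p ∩ r ∣ + ∣ q ∩ r ∣ + n)
  ∣p∣+∣q∣+∣r∣≤∣p∩q∣+∣p∩r∣+∣q∩r∣+n {n} p q r = begin
    ∣ p ∣ + ∣ q ∣ + ∣ r ∣                  ≡⟨ cong (_+ ∣ r ∣) (∣p∪q∣+∣p∩q∣≡∣p∣+∣q∣ p q) ⟨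
    ∣ p ∪ q ∣ + ∣ p ∩ q ∣ + ∣ r ∣          ≡⟨ cong (_+ ∣ r ∣) (+-comm (∣ p ∪ q ∣) (∣ p ∩ q ∣)) ⟩
    ∣ p ∩ q ∣ + ∣ p ∪ q ∣ + ∣ r ∣          ≡⟨ +-assoc (∣ p ∩ q ∣) (∣ p ∪ q ∣) (∣ r ∣) ⟩
    ∣ p ∩ q ∣ + (∣ p ∪ q ∣ + ∣ r ∣)        ≤⟨ +-monoʳ-≤ ∣ p ∩ q ∣ (∣p∣+∣q∣≤∣p∩q∣+n (p ∪ q) r) ⟩
    ∣ p ∩ q ∣ + (∣ (p ∪ q) ∩ r ∣ + n)      ≡⟨ cong (λ s → ∣ p ∩ q ∣ + (∣ s ∣ + n)) (∩-distribʳ-∪ r p q) ⟩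
    ∣ p ∩ q ∣ + (∣ (p ∩ r) ∪ (q ∩ r) ∣ + n) ≤⟨ +-monoʳ-≤ ∣ p ∩ q ∣ (+-monoˡ-≤ n (∣p∪q∣≤∣p∣+∣q∣ (p ∩ r) (q ∩ r))) ⟩
    ∣ p ∩ q ∣ + (∣ p ∩ r ∣ + ∣ q ∩ r ∣ + n) ∎
    where open ≤-Reasoning

  ∣p∣≡∣p∩q∣+∣p─q∣ : ∀ {n} (p q : Subset n) → ∣ p ∣ ≡ ∣ p ∩ q ∣ + ∣ p ─ q ∣
  ∣p∣≡∣p∩q∣+∣p─q∣ [] [] = refl
  ∣p∣≡∣p∩q∣+∣p─q∣ (true ∷ p) (true ∷ q) = cong suc (∣p∣≡∣p∩q∣+∣p─q∣ p q)
  ∣p∣≡∣p∩q∣+∣p─q∣ (true ∷ p) (false ∷ q) = trans (cong suc (∣p∣≡∣p∩q∣+∣p─q∣ p q)) (sym (+-suc _ _))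
  ∣p∣≡∣p∩q∣+∣p─q∣ (false ∷ p) (true ∷ q) = ∣p∣≡∣p∩q∣+∣p─q∣ p q
  ∣p∣≡∣p∩q∣+∣p─q∣ (false ∷ p) (false ∷ q) = ∣p∣≡∣p∩q∣+∣p─q∣ p q

  ∣p∣+∣∁p∣≡n : ∀ {n} (p : Subset n) → ∣ p ∣ + ∣ ∁ p ∣ ≡ n
  ∣p∣+∣∁p∣≡n p = trans (cong (∣ p ∣ +_) (∣∁p∣≡n∸∣p∣ p)) (m+[n∸m]≡n (∣p∣≤n p))

  ∣p∩q∣≡∣p∣≡∣q∣⇒p≡q : ∀ {n} (p q : Subset n) → ∣ p ∩ q ∣ ≡ ∣ p ∣ → ∣ p ∩ q ∣ ≡ ∣ q ∣ → p ≡ q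
  ∣p∩q∣≡∣p∣≡∣q∣⇒p≡q [] [] _ _ = refl
  ∣p∩q∣≡∣p∣≡∣q∣⇒p≡q (true ∷ p) (true ∷ q) eqp eqq =
    cong (true ∷_) (∣p∩q∣≡∣p∣≡∣q∣⇒p≡q p q (suc-injective eqp) (suc-injective eqq))
  ∣p∩q∣≡∣p∣≡∣q∣⇒p≡q (false ∷ p) (false ∷ q) eqp eqq = cong (false ∷_) (∣p∩q∣≡∣p∣≡∣q∣⇒p≡q p q eqp eqq)
  ∣p∩q∣≡∣p∣≡∣q∣⇒p≡q (true ∷ p) (false ∷ q) eqp _ = ⊥-elim (<-irrefl eqp (s≤s (∣p∩q∣≤∣p∣ p q)))
  ∣p∩q∣≡∣p∣≡∣q∣⇒p≡q (false ∷ p) (true ∷ q) _ eqq = ⊥-elim (<-irrefl eqq (s≤s (∣p∩q∣≤∣q∣ p q)))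

  subset-with-region-sizes : ∀ {n} (p q : Subset n) (a c b d : ℕ) →
    a ≤ ∣ p ∩ q ∣ → c ≤ ∣ p ─ q ∣ → b ≤ ∣ q ─ p ∣ → d ≤ ∣ ∁ (p ∪ q) ∣ →
    ∃ λ r → ∣ r ∣ ≡ (a + c) + (b + d) × ∣ p ∩ r ∣ ≡ a + c × ∣ r ∩ q ∣ ≡ a + b
  subset-with-region-sizes [] [] 0 0 0 0 _ _ _ _ = [] , refl , refl , refl
  subset-with-region-sizes (true ∷ p) (true ∷ q) (suc a) c b d (s≤s a≤) c≤ b≤ d≤
    with r , ∣r∣ , ∣p∩r∣ , ∣r∩q∣ ← subset-with-region-sizes p q a c b d a≤ c≤ b≤ d≤
    = true ∷ r , cong suc ∣r∣ , cong suc ∣p∩r∣ , cong suc ∣r∩q∣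
  subset-with-region-sizes (true ∷ p) (false ∷ q) a (suc c) b d a≤ (s≤s c≤) b≤ d≤
    with r , ∣r∣ , ∣p∩r∣ , ∣r∩q∣ ← subset-with-region-sizes p q a c b d a≤ c≤ b≤ d≤
    = true ∷ r , trans (cong suc ∣r∣) (cong (_+ (b + d)) (sym (+-suc a c)))
               , trans (cong suc ∣p∩r∣) (sym (+-suc a c)) , ∣r∩q∣
  subset-with-region-sizes (false ∷ p) (true ∷ q) a c (suc b) d a≤ c≤ (s≤s b≤) d≤
    with r , ∣r∣ , ∣p∩r∣ , ∣r∩q∣ ← subset-with-region-sizes p q a c b d a≤ c≤ b≤ d≤
    = true ∷ r , trans (cong suc ∣r∣) (sym (+-suc (a + c) (b + d)))
               , ∣p∩r∣ , trans (cong suc ∣r∩q∣) (sym (+-suc a b))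
  subset-with-region-sizes (false ∷ p) (false ∷ q) a c b (suc d) a≤ c≤ b≤ (s≤s d≤)
    with r , ∣r∣ , ∣p∩r∣ , ∣r∩q∣ ← subset-with-region-sizes p q a c b d a≤ c≤ b≤ d≤
    = true ∷ r
    , trans (cong suc ∣r∣) (trans (sym (+-suc (a + c) (b + d))) (cong ((a + c) +_) (sym (+-suc b d))))
    , ∣p∩r∣ , ∣r∩q∣
  subset-with-region-sizes (true ∷ p) (true ∷ q) 0 c b d _ c≤ b≤ d≤
    with r , ∣r∣ , ∣p∩r∣ , ∣r∩q∣ ← subset-with-region-sizes p q 0 c b d z≤n c≤ b≤ d≤
    = false ∷ r , ∣r∣ , ∣p∩r∣ , ∣r∩q∣
  subset-with-region-sizes (true ∷ p) (false ∷ q) a 0 b d a≤ _ b≤ d≤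
    with r , ∣r∣ , ∣p∩r∣ , ∣r∩q∣ ← subset-with-region-sizes p q a 0 b d a≤ z≤n b≤ d≤
    = false ∷ r , ∣r∣ , ∣p∩r∣ , ∣r∩q∣
  subset-with-region-sizes (false ∷ p) (true ∷ q) a c 0 d a≤ c≤ _ d≤
    with r , ∣r∣ , ∣p∩r∣ , ∣r∩q∣ ← subset-with-region-sizes p q a c 0 d a≤ c≤ z≤n d≤
    = false ∷ r , ∣r∣ , ∣p∩r∣ , ∣r∩q∣
  subset-with-region-sizes (false ∷ p) (false ∷ q) a c b 0 a≤ c≤ b≤ _
    with r , ∣r∣ , ∣p∩r∣ , ∣r∩q∣ ← subset-with-region-sizes p q a c b 0 a≤ c≤ b≤ z≤n
    = false ∷ r , ∣r∣ , ∣p∩r∣ , ∣r∩q∣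

-- Δ = suc d and k ∸ i = suc m, so that both divisors are visibly nonzero.
module Distance (v k i d m : ℕ)
  (Δ-eq : suc d + 2 * k ≡ v + 2 * i) (k-eq : k ≡ i + suc m) (2k≤v : 2 * k ≤ v) where

  i<k : i < k
  i<k = linear (≡⇒≥ k-eq ⊕ z≤n {m}) (solve (i ∷ m ∷ k ∷ []))

  i≤Δ : i ≤ suc d
  i≤Δ = linear (2k≤v ⊕ ≡⇒≥ Δ-eq ⊕ z≤n {i}) (solve (i ∷ d ∷ k ∷ v ∷ []))

  k∸i≡K : k ∸ i ≡ suc m
  k∸i≡K = m≡n+o⇒m∸n≡o i k-eq

  ⌈k∸_/Δ⌉ ⌈_∸i/Δ⌉ ⌈k∸_/K⌉ : ℕ → ℕ
  ⌈k∸ x /Δ⌉ = ceilDiv (k ∸ x) (suc d)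
  ⌈ x ∸i/Δ⌉ = ceilDiv (x ∸ i) (suc d)
  ⌈k∸ x /K⌉ = ceilDiv (k ∸ x) (suc m)

  -- The three cases of the formula: x < min(i, k − Δ), k − Δ ≤ x < i and i ≤ x.
  data Regime (x : ℕ) : Set where
    far   : x < i → x + suc d < k → Regime x
    near  : x < i → k ≤ x + suc d → Regime x
    above : i ≤ x → Regime x

  regime : ∀ x → Regime x
  regime x with x <? i | x + suc d <? k
  ... | yes x<i | yes x-far = far x<i x-far
  ... | yes x<i | no x-near = near x<i (≮⇒≥ x-near)
  ... | no x≮i  | _         = above (≮⇒≥ x≮i)

  dist-in : ∀ {x} → Regime x → ℕ
  dist-in     (far _ _)  = 3
  dist-in {x} (near _ _) = ⌈k∸ x /K⌉
  dist-in {x} (above _)  = 2 * ⌈k∸ x /Δ⌉ ⊓ (2 * ⌈ x ∸i/Δ⌉ + 1)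

  dist-in-irrelevant : ∀ {x} (r s : Regime x) → dist-in r ≡ dist-in s
  dist-in-irrelevant (far _ _)       (far _ _)       = refl
  dist-in-irrelevant (near _ _)      (near _ _)      = refl
  dist-in-irrelevant (above _)       (above _)       = refl
  dist-in-irrelevant (far _ x-far)   (near _ x-near) = contradiction x-near (<⇒≱ x-far)
  dist-in-irrelevant (near _ x-near) (far _ x-far)   = contradiction x-near (<⇒≱ x-far)
  dist-in-irrelevant (far x<i _)     (above i≤x)     = contradiction i≤x (<⇒≱ x<i)
  dist-in-irrelevant (near x<i _)    (above i≤x)     = contradiction i≤x (<⇒≱ x<i)
  dist-in-irrelevant (above i≤x)     (far x<i _)     = contradiction i≤x (<⇒≱ x<i)
  dist-in-irrelevant (above i≤x)     (near x<i _)    = contradiction i≤x (<⇒≱ x<i)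

  dist : ℕ → ℕ
  dist x = dist-in (regime x)

  dist≡ : ∀ {x} (r : Regime x) → dist x ≡ dist-in r
  dist≡ = dist-in-irrelevant (regime _)

  dist≤even : ∀ {x} → i ≤ x → dist x ≤ 2 * ⌈k∸ x /Δ⌉
  dist≤even i≤x = ≤-trans (≤-reflexive (dist≡ (above i≤x))) (m⊓n≤m _ _)

  dist≤odd : ∀ {x} → i ≤ x → dist x ≤ 2 * ⌈ x ∸i/Δ⌉ + 1
  dist≤odd i≤x = ≤-trans (≤-reflexive (dist≡ (above i≤x))) (m⊓n≤n _ _)

  dist-k : dist k ≡ 0
  dist-k = n≤0⇒n≡0 (begin
    dist k                ≤⟨ dist≤even (<⇒≤ i<k) ⟩
    2 * ⌈k∸ k /Δ⌉         ≡⟨ cong (λ n → 2 * ceilDiv n (suc d)) (n∸n≡0 k) ⟩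
    2 * ceilDiv 0 (suc d) ≡⟨ cong (2 *_) (ceilDiv-zero d) ⟩
    0                     ∎)
    where open ≤-Reasoning

  dist-i≤1 : dist i ≤ 1
  dist-i≤1 = begin
    dist i                    ≤⟨ dist≤odd ≤-refl ⟩
    2 * ⌈ i ∸i/Δ⌉ + 1         ≡⟨ cong (λ n → 2 * ceilDiv n (suc d) + 1) (n∸n≡0 i) ⟩
    2 * ceilDiv 0 (suc d) + 1 ≡⟨ cong (λ n → 2 * n + 1) (ceilDiv-zero d) ⟩
    1                         ∎
    where open ≤-Reasoning

  dist-in-pos : ∀ {x} (r : Regime x) → x < k → 1 ≤ dist-in r
  dist-in-pos (far _ _)  _   = s≤s z≤n
  dist-in-pos (near _ _) x<k = ceilDiv-pos m (m<n⇒0<n∸m x<k)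
  dist-in-pos (above _)  x<k =
    ⊓-glb (≤-trans (ceilDiv-pos d (m<n⇒0<n∸m x<k)) (m≤n*m _ 2)) (m≤n+m 1 _)

  dist-pos : ∀ {x} → x < k → 1 ≤ dist x
  dist-pos x<k = dist-in-pos (regime _) x<k

  dist≡0⇒≡k : ∀ {x} → x ≤ k → dist x ≡ 0 → x ≡ k
  dist≡0⇒≡k x≤k dist≡0 with m≤n⇒m<n∨m≡n x≤k
  ... | inj₁ x<k = contradiction dist≡0 (≢-sym (<⇒≢ (dist-pos x<k)))
  ... | inj₂ x≡k = x≡k

  dist≡suc⇒<k : ∀ {x n} → x ≤ k → dist x ≡ suc n → x < k
  dist≡suc⇒<k x≤k dist≡1+n = ≤∧≢⇒< x≤k λ { refl → 0≢1+n (trans (sym dist-k) dist≡1+n) }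

  -- Lower bound

  -- What inclusion–exclusion says about x = |A ∩ C| and y = |A' ∩ C| for k-sets
  -- A, A', C with |A ∩ A'| = i.
  record NeighbourSizes (x y : ℕ) : Set where
    field
      y≤k : y ≤ k
      x+y≤i+k : x + y ≤ i + k
      y+i≤x+k : y + i ≤ x + k
      3k≤i+x+y+v : k + k + k ≤ i + (x + y + v)
      2k≤y+v : k + k ≤ y + v

    k+i≤x+y+Δ : k + i ≤ x + y + suc d
    k+i≤x+y+Δ = linear (3k≤i+x+y+v ⊕ ≡⇒≥ Δ-eq) (solve (x ∷ y ∷ v ∷ k ∷ i ∷ d ∷ []))

    y<k : x < i → y < k
    y<k x<i = linear (y+i≤x+k ⊕ x<i) (solve (x ∷ y ∷ k ∷ i ∷ []))

  module _ {x y : ℕ} (ns : NeighbourSizes x y) where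
    open NeighbourSizes ns

    step-from-far : ∀ (s : Regime y) → x < i → x + suc d < k → 3 ≤ suc (dist-in s)
    step-from-far (far _ _)    _ _ = n≤1+n 3
    step-from-far (near y<i _) _ _ = s≤s (ceilDiv≥2 m K<k∸y)
      where
      K<k∸y : suc m < k ∸ y
      K<k∸y = subst (_< k ∸ y) k∸i≡K (∸-monoʳ-< y<i (<⇒≤ i<k))
    step-from-far (above i≤y) x<i x-far = s≤s (⊓-glb
      (*-monoʳ-≤ 2 (ceilDiv-pos d (m<n⇒0<n∸m (y<k x<i))))
      (≤-trans (*-monoʳ-≤ 2 (ceilDiv-pos d (m<n⇒0<n∸m i<y))) (m≤m+n _ 1)))
      where
      i<y : i < y
      i<y = linear (k+i≤x+y+Δ ⊕ x-far) (solve (x ∷ y ∷ k ∷ i ∷ d ∷ []))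

    step-from-near : ∀ (s : Regime y) → x < i → ⌈k∸ x /K⌉ ≤ suc (dist-in s)
    step-from-near (far _ y-far) _ = ≤-trans (ceilDiv≤2 m (m≤n+o⇒m∸n≤o k x k≤x+2K)) (s≤s (s≤s z≤n))
      where
      k≤x+2K : k ≤ x + (suc m + suc m)
      k≤x+2K = linear (2k≤y+v ⊕ y-far ⊕ ≡⇒≥ Δ-eq ⊕ ≤-reflexive k-eq ⊕ ≤-reflexive k-eq ⊕ z≤n {suc x})
                      (solve (x ∷ y ∷ v ∷ k ∷ i ∷ d ∷ m ∷ []))
    step-from-near (near y<i _) _ =
      ≤-trans (ceilDiv-monoˡ-≤ m k∸x≤k∸y+K) (≤-reflexive (ceilDiv-+-suc (k ∸ y) m))
      where
      k+y≤x+[k+K] : k + y ≤ x + (k + suc m)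
      k+y≤x+[k+K] = linear (y+i≤x+k ⊕ ≤-reflexive k-eq) (solve (x ∷ y ∷ k ∷ i ∷ m ∷ []))
      k∸x≤k∸y+K : k ∸ x ≤ k ∸ y + suc m
      k∸x≤k∸y+K = ≤-trans (m+n≤o+p⇒m∸o≤p∸n {k} {y} {x} {k + suc m} k+y≤x+[k+K])
                          (≤-reflexive (+-∸-comm (suc m) y≤k))
    step-from-near s@(above i≤y) x<i =
      ≤-trans (ceilDiv≤2 m (m≤n+o⇒m∸n≤o k x k≤x+2K)) (s≤s (dist-in-pos s (y<k x<i)))
      where
      k≤x+2K : k ≤ x + (suc m + suc m)
      k≤x+2K = linear (y+i≤x+k ⊕ i≤y ⊕ ≤-reflexive k-eq ⊕ ≤-reflexive k-eq)
                      (solve (x ∷ y ∷ k ∷ i ∷ m ∷ []))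

    step-to-below : (s : Regime y) → y < i → 2 * ⌈k∸ x /Δ⌉ ⊓ (2 * ⌈ x ∸i/Δ⌉ + 1) ≤ suc (dist-in s)
    step-to-below s y<i = ≤-trans (m⊓n≤m _ _)
      (≤-trans (*-monoʳ-≤ 2 (ceilDiv≤1 d (m≤n+o⇒m∸n≤o k x k≤x+Δ)))
               (s≤s (dist-in-pos s (<-trans y<i i<k))))
      where
      k≤x+Δ : k ≤ x + suc d
      k≤x+Δ = linear (k+i≤x+y+Δ ⊕ y<i ⊕ z≤n {1}) (solve (x ∷ y ∷ k ∷ i ∷ d ∷ []))

    step-from-above : ∀ (s : Regime y) → i ≤ x →
                      2 * ⌈k∸ x /Δ⌉ ⊓ (2 * ⌈ x ∸i/Δ⌉ + 1) ≤ suc (dist-in s)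
    step-from-above s@(far y<i _)  _ = step-to-below s y<i
    step-from-above s@(near y<i _) _ = step-to-below s y<i
    step-from-above (above i≤y) _ = ⊓-glb {_} {suc (2 * ⌈k∸ y /Δ⌉)} {suc (2 * ⌈ y ∸i/Δ⌉ + 1)}
      (≤-trans (m⊓n≤n _ _) (≤-trans (≤-reflexive (+-comm _ 1)) (s≤s (*-monoʳ-≤ 2 odd-x≤even-y))))
      (≤-trans (m⊓n≤m _ _) (≤-trans (*-monoʳ-≤ 2 even-x≤odd-y+1) (≤-reflexive (2*[1+n]≡1+[2*n+1] _))))
      where
      odd-x≤even-y : ⌈ x ∸i/Δ⌉ ≤ ⌈k∸ y /Δ⌉
      odd-x≤even-y = ceilDiv-monoˡ-≤ d (m+n≤o+p⇒m∸o≤p∸n {x} {y} {i} {k} x+y≤i+k)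
      k∸x≤y∸i+Δ : k ∸ x ≤ (y ∸ i) + suc d
      k∸x≤y∸i+Δ = ≤-trans
        (m+n≤o+p⇒m∸o≤p∸n {k} {i} {x} {y + suc d} (≤-trans k+i≤x+y+Δ (≤-reflexive (+-assoc x y (suc d)))))
        (≤-reflexive (+-∸-comm (suc d) i≤y))
      even-x≤odd-y+1 : ⌈k∸ x /Δ⌉ ≤ suc ⌈ y ∸i/Δ⌉
      even-x≤odd-y+1 = ≤-trans (ceilDiv-monoˡ-≤ d k∸x≤y∸i+Δ) (≤-reflexive (ceilDiv-+-suc (y ∸ i) d))

    dist-in-step : ∀ (r : Regime x) (s : Regime y) → dist-in r ≤ suc (dist-in s)
    dist-in-step (far x<i x-far)  s = step-from-far s x<i x-far
    dist-in-step (near x<i _)     s = step-from-near s x<i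
    dist-in-step (above i≤x)      s = step-from-above s i≤x

  dist-step : ∀ {x y} → NeighbourSizes x y → dist x ≤ suc (dist y)
  dist-step ns = dist-in-step ns (regime _) (regime _)

  neighbourSizes : ∀ (A A' C : Subset v) → ∣ A ∣ ≡ k → ∣ A' ∣ ≡ k → ∣ C ∣ ≡ k → ∣ A ∩ A' ∣ ≡ i →
                   NeighbourSizes ∣ A ∩ C ∣ ∣ A' ∩ C ∣
  neighbourSizes A A' C ∣A∣≡k ∣A'∣≡k ∣C∣≡k ∣A∩A'∣≡i = record
    { y≤k        = ≤-trans (∣p∩q∣≤∣p∣ A' C) (≤-reflexive ∣A'∣≡k)
    ; x+y≤i+k    = ≤-trans (∣p∩r∣+∣q∩r∣≤∣p∩q∣+∣r∣ A A' C) (≤-reflexive (cong₂ _+_ ∣A∩A'∣≡i ∣C∣≡k))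
    ; y+i≤x+k    = y+i≤x+k
    ; 3k≤i+x+y+v = subst₂ (λ a b → a ≤ b + (∣ A ∩ C ∣ + ∣ A' ∩ C ∣ + v))
                     (cong₂ _+_ (cong₂ _+_ ∣A∣≡k ∣A'∣≡k) ∣C∣≡k) ∣A∩A'∣≡i
                     (∣p∣+∣q∣+∣r∣≤∣p∩q∣+∣p∩r∣+∣q∩r∣+n A A' C)
    ; 2k≤y+v     = subst (_≤ ∣ A' ∩ C ∣ + v) (cong₂ _+_ ∣A'∣≡k ∣C∣≡k) (∣p∣+∣q∣≤∣p∩q∣+n A' C)
    }
    where
    open ≤-Reasoning
    y+i≤x+k : ∣ A' ∩ C ∣ + i ≤ ∣ A ∩ C ∣ + k
    y+i≤x+k = begin
      ∣ A' ∩ C ∣ + i           ≡⟨ cong₂ _+_ (cong ∣_∣ (∩-comm A' C)) (sym ∣A∩A'∣≡i) ⟩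
      ∣ C ∩ A' ∣ + ∣ A ∩ A' ∣  ≤⟨ ∣p∩r∣+∣q∩r∣≤∣p∩q∣+∣r∣ C A A' ⟩
      ∣ C ∩ A ∣ + ∣ A' ∣       ≡⟨ cong₂ _+_ (cong ∣_∣ (∩-comm C A)) ∣A'∣≡k ⟩
      ∣ A ∩ C ∣ + k            ∎

  dist≤length : ∀ {A C : Subset v} {n} → Walk v k i A C n → ∣ A ∣ ≡ k → ∣ C ∣ ≡ k →
                dist ∣ A ∩ C ∣ ≤ n
  dist≤length {A} here ∣A∣≡k _ =
    ≤-reflexive (trans (cong dist (trans (cong ∣_∣ (∩-idem A)) ∣A∣≡k)) dist-k)
  dist≤length {A} {C} (step {B = A'} ∣A'∣≡k ∣A∩A'∣≡i walk) ∣A∣≡k ∣C∣≡k =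
    ≤-trans (dist-step (neighbourSizes A A' C ∣A∣≡k ∣A'∣≡k ∣C∣≡k ∣A∩A'∣≡i))
            (s≤s (dist≤length walk ∣A'∣≡k ∣C∣≡k))

  -- Upper bound

  dist≡odd : ∀ {x} → i ≤ x → ⌈ x ∸i/Δ⌉ < ⌈k∸ x /Δ⌉ → dist x ≡ 2 * ⌈ x ∸i/Δ⌉ + 1
  dist≡odd {x} i≤x odd<even = trans (dist≡ (above i≤x)) (m≥n⇒m⊓n≡n (begin
    2 * ⌈ x ∸i/Δ⌉ + 1        <⟨ n<1+n _ ⟩
    suc (2 * ⌈ x ∸i/Δ⌉ + 1)  ≡⟨ 2*[1+n]≡1+[2*n+1] _ ⟨
    2 * suc ⌈ x ∸i/Δ⌉        ≤⟨ *-monoʳ-≤ 2 odd<even ⟩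
    2 * ⌈k∸ x /Δ⌉            ∎))
    where open ≤-Reasoning

  dist≡even : ∀ {x} → i ≤ x → ⌈k∸ x /Δ⌉ ≤ ⌈ x ∸i/Δ⌉ → dist x ≡ 2 * ⌈k∸ x /Δ⌉
  dist≡even i≤x even≤odd =
    trans (dist≡ (above i≤x)) (m≤n⇒m⊓n≡m (≤-trans (*-monoʳ-≤ 2 even≤odd) (m≤m+n _ 1)))

  2≤dist-even : ∀ {x} → i ≤ x → ⌈k∸ x /Δ⌉ ≤ ⌈ x ∸i/Δ⌉ → x < k → 2 ≤ dist x
  2≤dist-even i≤x even≤odd x<k =
    subst (2 ≤_) (sym (dist≡even i≤x even≤odd)) (*-monoʳ-≤ 2 (ceilDiv-pos d (m<n⇒0<n∸m x<k)))

  -- A neighbour A' of A at which the formula (evaluated at |A' ∩ B|) is smaller, described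
  -- by how many elements A' takes from A ∩ B, A ∖ B, B ∖ A and the complement of A ∪ B,
  -- which have x, p, p and e elements.
  record Descent (x p e : ℕ) : Set where
    field
      both onlyA onlyB neither : ℕ
      both≤x     : both ≤ x
      onlyA≤p    : onlyA ≤ p
      onlyB≤p    : onlyB ≤ p
      neither≤e  : neither ≤ e
      meets-in-i : both + onlyA ≡ i
      has-size-k : (both + onlyA) + (onlyB + neither) ≡ k
      decreases  : dist (both + onlyB) < dist x

  module _ {x p e : ℕ} (k≡x+p : k ≡ x + p) (v≡x+2p+e : v ≡ x + p + p + e) where

    Δ+x≡e+2i : suc d + x ≡ e + 2 * i
    Δ+x≡e+2i = linear-≡ (cong₂ _+_ (cong₂ _+_ (cong₂ _+_ Δ-eq v≡x+2p+e) (sym k≡x+p)) (sym k≡x+p))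
                        (solve (x ∷ p ∷ e ∷ v ∷ k ∷ i ∷ d ∷ []))

    k∸x≡p : k ∸ x ≡ p
    k∸x≡p = m≡n+o⇒m∸n≡o x k≡x+p

    i+s≡x⇒s≤e : ∀ {s} → i + s ≡ x → s ≤ e
    i+s≡x⇒s≤e {s} i+s≡x = linear (≤-reflexive Δ+x≡e+2i ⊕ ≤-reflexive i+s≡x ⊕ i≤Δ)
                                (solve (x ∷ e ∷ s ∷ i ∷ d ∷ []))

    descends-to-i : ∀ {y} → y ≡ i → 2 ≤ dist x → dist y < dist x
    descends-to-i refl 2≤dist = <-≤-trans (s≤s dist-i≤1) 2≤dist

    descent-odd : i ≤ x → ⌈ x ∸i/Δ⌉ < ⌈k∸ x /Δ⌉ → Descent x p e
    descent-odd i≤x odd<even with s , i+s≡x ← m≤n⇒∃[o]m+o≡n i≤x = record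
      { both = i ; onlyA = 0 ; onlyB = p ; neither = s
      ; both≤x = i≤x ; onlyA≤p = z≤n ; onlyB≤p = ≤-refl ; neither≤e = i+s≡x⇒s≤e i+s≡x
      ; meets-in-i = +-identityʳ i
      ; has-size-k = linear-≡ (cong₂ _+_ i+s≡x (sym k≡x+p)) (solve (x ∷ p ∷ s ∷ k ∷ i ∷ []))
      ; decreases = begin-strict
          dist (i + p)       ≤⟨ dist≤even (m≤m+n i p) ⟩
          2 * ⌈k∸ i + p /Δ⌉  ≡⟨ cong (λ n → 2 * ceilDiv n (suc d)) k∸[i+p]≡x∸i ⟩
          2 * ⌈ x ∸i/Δ⌉      <⟨ m<m+n _ z<s ⟩
          2 * ⌈ x ∸i/Δ⌉ + 1  ≡⟨ dist≡odd i≤x odd<even ⟨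
          dist x             ∎
      }
      where
      open ≤-Reasoning
      k∸[i+p]≡x∸i : k ∸ (i + p) ≡ x ∸ i
      k∸[i+p]≡x∸i = trans (m≡n+o⇒m∸n≡o (i + p) k≡[i+p]+s) (sym (m≡n+o⇒m∸n≡o i (sym i+s≡x)))
        where
        k≡[i+p]+s : k ≡ (i + p) + s
        k≡[i+p]+s = linear-≡ (cong₂ _+_ k≡x+p (sym i+s≡x)) (solve (x ∷ p ∷ s ∷ k ∷ i ∷ []))

    descent-even-p≤i : i ≤ x → p ≤ i → 2 ≤ dist x → Descent x p e
    descent-even-p≤i i≤x p≤i 2≤dist
      with s , i+s≡x ← m≤n⇒∃[o]m+o≡n i≤x | r , p+r≡i ← m≤n⇒∃[o]m+o≡n p≤i = record
      { both = r ; onlyA = p ; onlyB = p ; neither = s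
      ; both≤x = linear (≤-reflexive i+s≡x ⊕ ≤-reflexive p+r≡i ⊕ z≤n {s + p})
                        (solve (x ∷ p ∷ r ∷ s ∷ i ∷ []))
      ; onlyA≤p = ≤-refl ; onlyB≤p = ≤-refl ; neither≤e = i+s≡x⇒s≤e i+s≡x
      ; meets-in-i = r+p≡i
      ; has-size-k = linear-≡ (cong₂ _+_ (cong₂ _+_ p+r≡i i+s≡x) (sym k≡x+p))
                              (solve (x ∷ p ∷ r ∷ s ∷ k ∷ i ∷ []))
      ; decreases = descends-to-i r+p≡i 2≤dist
      }
      where
      r+p≡i : r + p ≡ i
      r+p≡i = trans (+-comm r p) p+r≡i

    descent-even-i<p≤Δ : i ≤ x → i < p → p ≤ suc d → 2 ≤ dist x → Descent x p e
    descent-even-i<p≤Δ i≤x i<p p≤Δ 2≤dist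
      with t , 2i+t≡x+p ← m≤n⇒∃[o]m+o≡n (+-mono-≤ i≤x (<⇒≤ i<p)) = record
      { both = 0 ; onlyA = i ; onlyB = i ; neither = t
      ; both≤x = z≤n ; onlyA≤p = <⇒≤ i<p ; onlyB≤p = <⇒≤ i<p
      ; neither≤e = linear (≤-reflexive 2i+t≡x+p ⊕ p≤Δ ⊕ ≤-reflexive Δ+x≡e+2i)
                           (solve (x ∷ p ∷ e ∷ t ∷ i ∷ d ∷ []))
      ; meets-in-i = refl
      ; has-size-k = linear-≡ (cong₂ _+_ 2i+t≡x+p (sym k≡x+p)) (solve (x ∷ p ∷ t ∷ k ∷ i ∷ []))
      ; decreases = descends-to-i refl 2≤dist
      }

    descent-even-Δ<p : i ≤ x → ⌈k∸ x /Δ⌉ ≤ ⌈ x ∸i/Δ⌉ → suc d < p → Descent x p e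
    descent-even-Δ<p i≤x even≤odd Δ<p with t , Δ+t≡p ← m≤n⇒∃[o]m+o≡n (<⇒≤ Δ<p) = record
      { both = 0 ; onlyA = i ; onlyB = t + i ; neither = e
      ; both≤x = z≤n ; onlyA≤p = ≤-trans i≤Δ (<⇒≤ Δ<p)
      ; onlyB≤p = linear (i≤Δ ⊕ ≤-reflexive Δ+t≡p) (solve (p ∷ t ∷ i ∷ d ∷ []))
      ; neither≤e = ≤-refl
      ; meets-in-i = refl
      ; has-size-k = linear-≡ (cong₂ _+_ (cong₂ _+_ Δ+t≡p (sym Δ+x≡e+2i)) (sym k≡x+p))
                              (solve (x ∷ p ∷ e ∷ t ∷ k ∷ i ∷ d ∷ []))
      ; decreases = begin-strict
          dist (t + i)                     ≤⟨ dist≤odd (m≤n+m i t) ⟩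
          2 * ⌈ t + i ∸i/Δ⌉ + 1            ≡⟨ cong (λ n → 2 * ceilDiv n (suc d) + 1) (m+n∸n≡m t i) ⟩
          2 * ceilDiv t (suc d) + 1        <⟨ n<1+n _ ⟩
          suc (2 * ceilDiv t (suc d) + 1)  ≡⟨ 2*[1+n]≡1+[2*n+1] _ ⟨
          2 * suc (ceilDiv t (suc d))      ≡⟨ cong (2 *_) (ceilDiv-+-suc t d) ⟨
          2 * ceilDiv (t + suc d) (suc d)  ≡⟨ cong (λ n → 2 * ceilDiv n (suc d)) k∸x≡t+Δ ⟨
          2 * ⌈k∸ x /Δ⌉                    ≡⟨ dist≡even i≤x even≤odd ⟨
          dist x                           ∎
      }
      where
      open ≤-Reasoning
      k∸x≡t+Δ : k ∸ x ≡ t + suc d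
      k∸x≡t+Δ = trans k∸x≡p (trans (sym Δ+t≡p) (+-comm (suc d) t))

    descent-even : i ≤ x → ⌈k∸ x /Δ⌉ ≤ ⌈ x ∸i/Δ⌉ → x < k → Descent x p e
    descent-even i≤x even≤odd x<k with suc d <? p | p ≤? i
    ... | yes Δ<p | _       = descent-even-Δ<p i≤x even≤odd Δ<p
    ... | no Δ≮p  | yes p≤i = descent-even-p≤i i≤x p≤i (2≤dist-even i≤x even≤odd x<k)
    ... | no Δ≮p  | no p≰i  = descent-even-i<p≤Δ i≤x (≰⇒> p≰i) (≮⇒≥ Δ≮p) (2≤dist-even i≤x even≤odd x<k)

    i+e≤x+p : x + suc d < k → i + e ≤ x + p
    i+e≤x+p x-far = linear (≡⇒≥ Δ+x≡e+2i ⊕ x-far ⊕ ≤-reflexive k≡x+p ⊕ z≤n {suc i})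
                           (solve (x ∷ p ∷ e ∷ k ∷ i ∷ d ∷ []))

    descent-far : x < i → x + suc d < k → Descent x p e
    descent-far x<i x-far with s , i+e+s≡x+p ← m≤n⇒∃[o]m+o≡n (i+e≤x+p x-far) = record
      { both = 0 ; onlyA = i ; onlyB = s ; neither = e
      ; both≤x = z≤n
      ; onlyA≤p = linear (i≤Δ ⊕ x-far ⊕ ≤-reflexive k≡x+p ⊕ z≤n {1}) (solve (x ∷ p ∷ k ∷ i ∷ d ∷ []))
      ; onlyB≤p = linear (≤-reflexive i+e+s≡x+p ⊕ x<i ⊕ z≤n {suc e}) (solve (x ∷ p ∷ e ∷ s ∷ i ∷ []))
      ; neither≤e = ≤-refl
      ; meets-in-i = refl
      ; has-size-k = linear-≡ (cong₂ _+_ i+e+s≡x+p (sym k≡x+p)) (solve (x ∷ p ∷ e ∷ s ∷ k ∷ i ∷ []))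
      ; decreases = begin-strict
          dist s         ≤⟨ dist≤even i≤s ⟩
          2 * ⌈k∸ s /Δ⌉  ≤⟨ *-monoʳ-≤ 2 (ceilDiv≤1 d (m≤n+o⇒m∸n≤o k s k≤s+Δ)) ⟩
          2              <⟨ n<1+n 2 ⟩
          3              ≡⟨ dist≡ (far x<i x-far) ⟨
          dist x         ∎
      }
      where
      open ≤-Reasoning
      i≤s : i ≤ s
      i≤s = linear (≡⇒≥ i+e+s≡x+p ⊕ ≡⇒≥ Δ+x≡e+2i ⊕ x-far ⊕ ≤-reflexive k≡x+p ⊕ z≤n {1})
                   (solve (x ∷ p ∷ e ∷ s ∷ k ∷ i ∷ d ∷ []))
      k≤s+Δ : k ≤ s + suc d
      k≤s+Δ = linear (≡⇒≥ i+e+s≡x+p ⊕ ≤-reflexive k≡x+p ⊕ ≡⇒≥ Δ+x≡e+2i ⊕ x<i ⊕ z≤n {1})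
                     (solve (x ∷ p ∷ e ∷ s ∷ k ∷ i ∷ d ∷ []))

    module _ (x<i : x < i) (k≤x+Δ : k ≤ x + suc d) where

      K<p : suc m < p
      K<p = linear (≡⇒≥ k-eq ⊕ ≤-reflexive k≡x+p ⊕ x<i) (solve (x ∷ p ∷ k ∷ i ∷ m ∷ []))

      2≤dist-near : 2 ≤ dist x
      2≤dist-near = subst (2 ≤_) (sym (dist≡ (near x<i k≤x+Δ)))
                          (ceilDiv≥2 m (subst (suc m <_) (sym k∸x≡p) K<p))

      descent-near-x+K<i : x + suc m < i → Descent x p e
      descent-near-x+K<i x+K<i
        with c , x+c≡i ← m≤n⇒∃[o]m+o≡n (<⇒≤ x<i) | q , K+q≡p ← m≤n⇒∃[o]m+o≡n (<⇒≤ K<p) = record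
        { both = x ; onlyA = c ; onlyB = suc m ; neither = 0
        ; both≤x = ≤-refl
        ; onlyA≤p = linear (≤-reflexive x+c≡i ⊕ <⇒≤ i<k ⊕ ≤-reflexive k≡x+p)
                           (solve (x ∷ p ∷ c ∷ k ∷ i ∷ []))
        ; onlyB≤p = <⇒≤ K<p
        ; neither≤e = z≤n
        ; meets-in-i = x+c≡i
        ; has-size-k = linear-≡ (cong₂ _+_ x+c≡i (sym k-eq)) (solve (x ∷ c ∷ k ∷ i ∷ m ∷ []))
        ; decreases = begin-strict
            dist (x + suc m)             ≡⟨ dist≡ (near x+K<i k≤x+K+Δ) ⟩
            ⌈k∸ x + suc m /K⌉            ≡⟨ cong (λ n → ceilDiv n (suc m)) k∸[x+K]≡q ⟩
            ceilDiv q (suc m)            <⟨ n<1+n _ ⟩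
            suc (ceilDiv q (suc m))      ≡⟨ ceilDiv-+-suc q m ⟨
            ceilDiv (q + suc m) (suc m)  ≡⟨ cong (λ n → ceilDiv n (suc m)) k∸x≡q+K ⟨
            ⌈k∸ x /K⌉                    ≡⟨ dist≡ (near x<i k≤x+Δ) ⟨
            dist x                       ∎
        }
        where
        open ≤-Reasoning
        k≤x+K+Δ : k ≤ x + suc m + suc d
        k≤x+K+Δ = ≤-trans k≤x+Δ (+-monoˡ-≤ (suc d) (m≤m+n x (suc m)))
        k∸[x+K]≡q : k ∸ (x + suc m) ≡ q
        k∸[x+K]≡q = m≡n+o⇒m∸n≡o (x + suc m)
          (linear-≡ (cong₂ _+_ k≡x+p (sym K+q≡p)) (solve (x ∷ p ∷ q ∷ k ∷ m ∷ [])))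
        k∸x≡q+K : k ∸ x ≡ q + suc m
        k∸x≡q+K = trans k∸x≡p (trans (sym K+q≡p) (+-comm (suc m) q))

      descent-near-K≤i≤x+K : i ≤ x + suc m → suc m ≤ i → Descent x p e
      descent-near-K≤i≤x+K i≤x+K K≤i with r , K+r≡i ← m≤n⇒∃[o]m+o≡n K≤i = record
        { both = r ; onlyA = suc m ; onlyB = suc m ; neither = 0
        ; both≤x = linear (i≤x+K ⊕ ≤-reflexive K+r≡i) (solve (x ∷ r ∷ i ∷ m ∷ []))
        ; onlyA≤p = <⇒≤ K<p ; onlyB≤p = <⇒≤ K<p ; neither≤e = z≤n
        ; meets-in-i = r+K≡i
        ; has-size-k = linear-≡ (cong₂ _+_ K+r≡i (sym k-eq)) (solve (r ∷ k ∷ i ∷ m ∷ []))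
        ; decreases = descends-to-i r+K≡i 2≤dist-near
        }
        where
        r+K≡i : r + suc m ≡ i
        r+K≡i = trans (+-comm r (suc m)) K+r≡i

      descent-near-i<K : i < suc m → Descent x p e
      descent-near-i<K i<K with t , i+t≡K ← m≤n⇒∃[o]m+o≡n (<⇒≤ i<K) = record
        { both = 0 ; onlyA = i ; onlyB = i ; neither = t
        ; both≤x = z≤n ; onlyA≤p = <⇒≤ (<-trans i<K K<p) ; onlyB≤p = <⇒≤ (<-trans i<K K<p)
        ; neither≤e = linear (≤-reflexive i+t≡K ⊕ ≡⇒≥ k-eq ⊕ k≤x+Δ ⊕ ≤-reflexive Δ+x≡e+2i)
                             (solve (x ∷ e ∷ t ∷ k ∷ i ∷ d ∷ m ∷ []))
        ; meets-in-i = refl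
        ; has-size-k = linear-≡ (cong₂ _+_ i+t≡K (sym k-eq)) (solve (t ∷ k ∷ i ∷ m ∷ []))
        ; decreases = descends-to-i refl 2≤dist-near
        }

    descent : x < k → Descent x p e
    descent x<k with regime x
    ... | far x<i x-far = descent-far x<i x-far
    ... | near x<i k≤x+Δ with x + suc m <? i | suc m ≤? i
    ...   | yes x+K<i | _       = descent-near-x+K<i x<i k≤x+Δ x+K<i
    ...   | no x+K≮i  | yes K≤i = descent-near-K≤i≤x+K x<i k≤x+Δ (≮⇒≥ x+K≮i) K≤i
    ...   | no _      | no K≰i  = descent-near-i<K x<i k≤x+Δ (≰⇒> K≰i)
    descent x<k | above i≤x with ⌈ x ∸i/Δ⌉ <? ⌈k∸ x /Δ⌉
    ...   | yes odd<even = descent-odd i≤x odd<even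
    ...   | no odd≮even  = descent-even i≤x (≮⇒≥ odd≮even) x<k

  ∣A∩B∣≤k : ∀ (A B : Subset v) → ∣ A ∣ ≡ k → ∣ A ∩ B ∣ ≤ k
  ∣A∩B∣≤k A B ∣A∣≡k = ≤-trans (∣p∩q∣≤∣p∣ A B) (≤-reflexive ∣A∣≡k)

  open Descent

  module _ (A B : Subset v) (∣A∣≡k : ∣ A ∣ ≡ k) (∣B∣≡k : ∣ B ∣ ≡ k) where

    k≡x+p : k ≡ ∣ A ∩ B ∣ + ∣ A ─ B ∣
    k≡x+p = trans (sym ∣A∣≡k) (∣p∣≡∣p∩q∣+∣p─q∣ A B)

    ∣B─A∣≡∣A─B∣ : ∣ B ─ A ∣ ≡ ∣ A ─ B ∣
    ∣B─A∣≡∣A─B∣ = +-cancelˡ-≡ ∣ A ∩ B ∣ _ _ (trans (sym k≡x+∣B─A∣) k≡x+p)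
      where
      k≡x+∣B─A∣ : k ≡ ∣ A ∩ B ∣ + ∣ B ─ A ∣
      k≡x+∣B─A∣ = trans (sym ∣B∣≡k)
        (trans (∣p∣≡∣p∩q∣+∣p─q∣ B A) (cong (λ s → ∣ s ∣ + ∣ B ─ A ∣) (∩-comm B A)))

    v≡x+2p+e : v ≡ ∣ A ∩ B ∣ + ∣ A ─ B ∣ + ∣ A ─ B ∣ + ∣ ∁ (A ∪ B) ∣
    v≡x+2p+e = count (∣ A ∪ B ∣) (∣ A ∩ B ∣) (∣ A ─ B ∣) (∣ ∁ (A ∪ B) ∣)
      (sym (∣p∣+∣∁p∣≡n (A ∪ B))) (trans (∣p∪q∣+∣p∩q∣≡∣p∣+∣q∣ A B) (cong₂ _+_ ∣A∣≡k ∣B∣≡k)) k≡x+p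
      where
      count : ∀ u x p e → v ≡ u + e → u + x ≡ k + k → k ≡ x + p → v ≡ x + p + p + e
      count u x p e v≡u+e u+x≡2k k≡x+p =
        linear-≡ (cong₂ _+_ (cong₂ _+_ v≡u+e u+x≡2k) (cong₂ _+_ k≡x+p k≡x+p))
                 (solve (u ∷ x ∷ p ∷ e ∷ v ∷ k ∷ []))

    descending-neighbour : ∣ A ∩ B ∣ < k →
      ∃ λ A' → ∣ A' ∣ ≡ k × ∣ A ∩ A' ∣ ≡ i × dist ∣ A' ∩ B ∣ < dist ∣ A ∩ B ∣
    descending-neighbour x<k with δ ← descent k≡x+p v≡x+2p+e x<k
      with A' , ∣A'∣≡ , ∣A∩A'∣≡ , ∣A'∩B∣≡
             ← subset-with-region-sizes A B (both δ) (onlyA δ) (onlyB δ) (neither δ)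
                 (both≤x δ) (onlyA≤p δ) (subst (onlyB δ ≤_) (sym ∣B─A∣≡∣A─B∣) (onlyB≤p δ)) (neither≤e δ)
      = A' , trans ∣A'∣≡ (has-size-k δ) , trans ∣A∩A'∣≡ (meets-in-i δ)
      , subst (λ y → dist y < dist ∣ A ∩ B ∣) (sym ∣A'∩B∣≡) (decreases δ)

  neighbour-one-step-closer : ∀ (A B : Subset v) {n} → ∣ A ∣ ≡ k → ∣ B ∣ ≡ k →
    dist ∣ A ∩ B ∣ ≡ suc n →
    ∃ λ A' → ∣ A' ∣ ≡ k × ∣ A ∩ A' ∣ ≡ i × dist ∣ A' ∩ B ∣ ≡ n
  neighbour-one-step-closer A B {n} ∣A∣≡k ∣B∣≡k dist≡1+n =
    map₂ (λ {A'} (∣A'∣≡k , ∣A∩A'∣≡i , closer) → ∣A'∣≡k , ∣A∩A'∣≡i , ≤-antisym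
           (s≤s⁻¹ (subst (dist ∣ A' ∩ B ∣ <_) dist≡1+n closer))
           (s≤s⁻¹ (subst (_≤ suc (dist ∣ A' ∩ B ∣)) dist≡1+n
                         (dist-step (neighbourSizes A A' B ∣A∣≡k ∣A'∣≡k ∣B∣≡k ∣A∩A'∣≡i)))))
         (descending-neighbour A B ∣A∣≡k ∣B∣≡k (dist≡suc⇒<k (∣A∩B∣≤k A B ∣A∣≡k) dist≡1+n))

  walk-of-length-dist : ∀ n (A B : Subset v) → ∣ A ∣ ≡ k → ∣ B ∣ ≡ k → dist ∣ A ∩ B ∣ ≡ n →
                        Walk v k i A B n
  walk-of-length-dist zero A B ∣A∣≡k ∣B∣≡k dist≡0 = subst (λ C → Walk v k i A C 0) A≡B here
    where
    x≡k : ∣ A ∩ B ∣ ≡ k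
    x≡k = dist≡0⇒≡k (∣A∩B∣≤k A B ∣A∣≡k) dist≡0
    A≡B : A ≡ B
    A≡B = ∣p∩q∣≡∣p∣≡∣q∣⇒p≡q A B (trans x≡k (sym ∣A∣≡k)) (trans x≡k (sym ∣B∣≡k))
  walk-of-length-dist (suc n) A B ∣A∣≡k ∣B∣≡k dist≡1+n =
    step-to (neighbour-one-step-closer A B ∣A∣≡k ∣B∣≡k dist≡1+n)
    where
    step-to : (∃ λ A' → ∣ A' ∣ ≡ k × ∣ A ∩ A' ∣ ≡ i × dist ∣ A' ∩ B ∣ ≡ n) → Walk v k i A B (suc n)
    step-to (A' , ∣A'∣≡k , ∣A∩A'∣≡i , dist≡n) =
      step ∣A'∣≡k ∣A∩A'∣≡i (walk-of-length-dist n A' B ∣A'∣≡k ∣B∣≡k dist≡n)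

  isDist : ∀ (A B : Subset v) → ∣ A ∣ ≡ k → ∣ B ∣ ≡ k → IsDist v k i A B (dist ∣ A ∩ B ∣)
  isDist A B ∣A∣≡k ∣B∣≡k =
    walk-of-length-dist _ A B ∣A∣≡k ∣B∣≡k refl , λ n walk → dist≤length walk ∣A∣≡k ∣B∣≡k

Δ≡0⇒degenerate : ∀ {v k i} → 2 * k ≤ v → Δ v k i ≡ 0 → v ≡ 2 * k × i ≡ 0
Δ≡0⇒degenerate {v} {k} {i} 2k≤v Δ≡0 =
    ≤-antisym (m∸n≡0⇒m≤n (m+n≡0⇒m≡0 (v ∸ 2 * k) Δ≡0)) 2k≤v
  , m+n≡0⇒m≡0 i (m+n≡0⇒n≡0 (v ∸ 2 * k) Δ≡0)

theorem3p4 : (v k i : ℕ) → i < k → k < v → 2 * k ≤ v → ¬ (v ≡ 2 * k × i ≡ 0) →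
    (A B : Subset v) → ∣ A ∣ ≡ k → ∣ B ∣ ≡ k →
      ((∣ A ∩ B ∣ < i) → (∣ A ∩ B ∣ + Δ v k i < k) → IsDist v k i A B 3)
      × ((k ≤ ∣ A ∩ B ∣ + Δ v k i) → (∣ A ∩ B ∣ < i) →
           IsDist v k i A B (ceilDiv (k ∸ ∣ A ∩ B ∣) (k ∸ i)))
      × ((i ≤ ∣ A ∩ B ∣) →
           IsDist v k i A B ((2 * ceilDiv (k ∸ ∣ A ∩ B ∣) (Δ v k i))
                              ⊓ (2 * ceilDiv (∣ A ∩ B ∣ ∸ i) (Δ v k i) + 1)))
theorem3p4 v k i i<k _ 2k≤v nondegenerate A B ∣A∣≡k ∣B∣≡k with Δ v k i in Δ≡ | k ∸ i in k∸i≡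
... | zero  | _     = ⊥-elim (nondegenerate (Δ≡0⇒degenerate {v} {k} {i} 2k≤v Δ≡))
... | suc d | zero  = ⊥-elim (<⇒≱ i<k (m∸n≡0⇒m≤n k∸i≡))
... | suc d | suc m =
    (λ x<i x-far → at (far x<i x-far))
  , (λ k≤x+Δ x<i → at (near x<i k≤x+Δ))
  , (λ i≤x → at (above i≤x))
  where
  Δ-eq : suc d + 2 * k ≡ v + 2 * i
  Δ-eq = begin
    suc d + 2 * k              ≡⟨ cong (_+ 2 * k) Δ≡ ⟨
    v ∸ 2 * k + 2 * i + 2 * k  ≡⟨ xy∙z≈xz∙y +-commutativeSemigroup (v ∸ 2 * k) (2 * i) (2 * k) ⟩
    v ∸ 2 * k + 2 * k + 2 * i  ≡⟨ cong (_+ 2 * i) (m∸n+n≡m 2k≤v) ⟩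
    v + 2 * i                  ∎
    where open ≡-Reasoning
  open Distance v k i d m Δ-eq (trans (sym (m+[n∸m]≡n (<⇒≤ i<k))) (cong (i +_) k∸i≡)) 2k≤v
  at : (r : Regime ∣ A ∩ B ∣) → IsDist v k i A B (dist-in r)
  at r = subst (IsDist v k i A B) (dist≡ r) (isDist A B ∣A∣≡k ∣B∣≡k)
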